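{- Let $H$ be a $k$-partite $k$-graph with partition classes $V_1,\dots,V_k$, each of size $n$, and suppose the largest matching in $H$ has size $m$. (a) If for some vertex $v$ the hypergraph $H\setminus v$ (obtained by deleting $v$ and all edges containing it) contains a matching of size $m$, then $\deg(v)\le n^{k-1}-(n-m)^{k-1}$. (b) If $T$ is a legal $k$-set such that $H\setminus T$ contains a matching of size $m-k+1$, then there is $v\in T$ with $\deg(v)\le n^{k-1}-(n-m)^{k-1}\le kmn^{k-2}$.
   Context: A $k$-partite $k$-graph has vertex classes $V_1,\dots,V_k$ and edges that are $k$-sets meeting each class in exactly one vertex. $\deg(v)$ is the number of edges containing $v$. A matching is a set of pairwise disjoint edges. A set $T$ of vertices is legal if $|T\cap V_i|\le 1$ for every $i$. $H\setminus T$ denotes the hypergraph obtained by deleting the vertices of $T$ and all edges meeting $T$. -}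

module Defs where

open import Data.Nat using (ℕ; _≤_)
open import Data.Fin using (Fin) renaming (_≟_ to _≟ᶠ_)
open import Data.Vec using (Vec; lookup)
open import Data.List using (List; length; filter)
open import Data.List.Membership.Propositional using (_∈_)
open import Data.List.Relation.Unary.All using (All)
open import Data.List.Relation.Unary.Unique.Propositional using (Unique)
open import Data.List.Relation.Unary.AllPairs using (AllPairs)
open import Data.Product using (Σ; _×_; proj₁; proj₂; _,_)
open import Relation.Binary.PropositionalEquality using (_≡_; _≢_)
open import Relation.Nullary using (¬_)

-- A k-partite k-graph with classes V_1..V_k, each of size n.
-- A vertex is a pair (i , x): the x-th vertex of class V_i.
Vertex : ℕ → ℕ → Set
Vertex k n = Fin k × Fin n

-- An edge meets each class in exactly one vertex: it is given by the
-- vertex it picks in each class.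
Edge : ℕ → ℕ → Set
Edge k n = Vec (Fin n) k

record KGraph (k n : ℕ) : Set where
  field
    edges    : List (Edge k n)
    distinct : Unique edges
open KGraph public

_∋ᵉ_ : ∀ {k n} → Edge k n → Vertex k n → Set
e ∋ᵉ (i , x) = lookup e i ≡ x

deg : ∀ {k n} → KGraph k n → Vertex k n → ℕ
deg H (i , x) = length (filter (λ e → lookup e i ≟ᶠ x) (edges H))

DisjointEdges : ∀ {k n} → Edge k n → Edge k n → Set
DisjointEdges e f = ∀ i → lookup e i ≢ lookup f i

IsMatching : ∀ {k n} → KGraph k n → List (Edge k n) → Set
IsMatching H M = All (_∈ edges H) M × AllPairs DisjointEdges M

-- a matching of H \ T (T a set of vertices, as a list): a matching of H
-- none of whose edges meets T (deleting T deletes all edges meeting T)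
IsMatchingAvoiding : ∀ {k n} → KGraph k n → List (Vertex k n) → List (Edge k n) → Set
IsMatchingAvoiding H T M = IsMatching H M × All (λ e → All (λ u → ¬ (e ∋ᵉ u)) T) M

MaxMatchingSize : ∀ {k n} → KGraph k n → ℕ → Set
MaxMatchingSize H m =
  Σ (List _) (λ M → IsMatching H M × length M ≡ m)
  × (∀ M → IsMatching H M → length M ≤ m)

Legal : ∀ {k n} → List (Vertex k n) → Set
Legal {k} T = ∀ (i : Fin k) → length (filter (λ u → proj₁ u ≟ᶠ i) T) ≤ 1

LegalKSet : ∀ {k n} → List (Vertex k n) → Set
LegalKSet {k} T = Unique T × length T ≡ k × Legal T

module Submission where

-- Write D = n^(k-1) - (n-m)^(k-1).  The heart of the proof is a counting fact
-- (avoiding-edge): if deg(v) > D for v in class i, and in every other class j a set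
-- F_j of at most m "forbidden" vertices is given, then some edge through v avoids
-- every F_j.  Indeed, the edges through v lie in a box of n^(k-1) vectors, and the
-- sub-box of vectors avoiding all F_j has at least (n-m)^(k-1) elements; if no edge
-- through v lay in the sub-box, deg(v) would be at most the difference, D.
--
-- A greedy argument follows (greedy-matching): given a matching M avoiding a set R
-- of high-degree vertices with |M| + |R| ≤ m + 1, repeatedly pick a vertex of R and
-- an edge through it avoiding M and the rest of R (forbidding their ≤ m vertices),
-- producing a matching of size |M| + |R|.  With |M| + |R| = m + 1 this contradicts
-- maximality, so some vertex of R has degree ≤ D (low-degree-vertex).  Parts (a)
-- and (b) are this fact for R = {v} and R = T; the estimate D ≤ k m n^(k-2) in (b)
-- is elementary arithmetic (degree-bound-estimate).

open import Defs
open import Data.Nat using (ℕ; zero; suc; _≤_; _+_; _*_; _∸_; _^_; z≤n; s≤s; _≤?_)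
open import Data.Nat.Properties
open import Data.Nat.Tactic.RingSolver using (solve-∀)
open import Algebra.Properties.CommutativeSemigroup *-commutativeSemigroup using (x∙yz≈y∙xz)
open import Data.Fin using (Fin; zero; suc; punchIn) renaming (_≟_ to _≟ᶠ_)
open import Data.Fin.Properties using (punchInᵢ≢i)
open import Data.Vec using (Vec; []; _∷_; lookup)
open import Data.Vec.Properties using (∷-injective; ≡-dec)
open import Data.List using (List; []; _∷_; length; map; _++_; [_]; filter; allFin; cartesianProductWith)
open import Data.List.Properties using (length-++; length-map; length-tabulate)
open import Data.List.Membership.Propositional using (_∈_; _∉_; find)
open import Data.List.Membership.Propositional.Properties
  using (∈-∃++; ∈-++⁻; ∈-++⁺ˡ; ∈-++⁺ʳ; ∈-map⁺; ∈-filter⁺; ∈-filter⁻; ∈-allFin;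
         ∈-cartesianProductWith⁺; ∈-cartesianProductWith⁻)
import Data.List.Membership.DecPropositional as DecMembership
open import Data.List.Relation.Binary.Subset.Propositional using (_⊆_)
open import Data.List.Relation.Binary.Disjoint.Propositional using (Disjoint)
open import Data.List.Relation.Unary.Any as Any using (Any; here; there; any?)
open import Data.List.Relation.Unary.All as All using (All; []; _∷_)
open import Data.List.Relation.Unary.All.Properties using (¬Any⇒All¬; All¬⇒¬Any)
open import Data.List.Relation.Unary.AllPairs using ([]; _∷_)
open import Data.List.Relation.Unary.Unique.Propositional using (Unique)
import Data.List.Relation.Unary.Unique.Propositional.Properties as Unique
open import Data.Product using (Σ; _×_; _,_; proj₁; proj₂)
open import Data.Sum using (inj₁; inj₂)
open import Data.Empty using (⊥; ⊥-elim)
open import Function using (_∘_)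
open import Relation.Nullary using (¬_; Dec; yes; no)
open import Relation.Binary.PropositionalEquality
  using (_≡_; _≢_; refl; sym; trans; cong; cong₂; subst; module ≡-Reasoning)

degreeBound : ℕ → ℕ → ℕ → ℕ
degreeBound k n m = n ^ (k ∸ 1) ∸ (n ∸ m) ^ (k ∸ 1)

power-increment : ∀ p b d → (b + d) ^ suc p ≤ b ^ suc p + suc p * d * (b + d) ^ p
power-increment zero b d = ≤-reflexive (base b d)
  where
  base : ∀ b d → (b + d) * 1 ≡ b * 1 + 1 * d * 1
  base = solve-∀
power-increment (suc p) b d = begin
    (b + d) * (b + d) ^ suc p
  ≤⟨ *-monoʳ-≤ (b + d) (power-increment p b d) ⟩
    (b + d) * (b ^ suc p + suc p * d * (b + d) ^ p)
  ≡⟨ expand b d (b ^ suc p) ((b + d) ^ p) p ⟩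
    b * b ^ suc p + d * b ^ suc p + suc p * d * (b + d) ^ suc p
  ≤⟨ +-monoˡ-≤ _ (+-monoʳ-≤ (b * b ^ suc p) (*-monoʳ-≤ d (^-monoˡ-≤ (suc p) (m≤m+n b d)))) ⟩
    b * b ^ suc p + d * (b + d) ^ suc p + suc p * d * (b + d) ^ suc p
  ≡⟨ collect b d (b ^ suc p) ((b + d) ^ suc p) p ⟩
    b * b ^ suc p + suc (suc p) * d * (b + d) ^ suc p
  ∎
  where
  open ≤-Reasoning
  expand : ∀ b d X Y p → (b + d) * (X + suc p * d * Y) ≡ b * X + d * X + suc p * d * ((b + d) * Y)
  expand = solve-∀
  collect : ∀ b d X Z p → b * X + d * Z + suc p * d * Z ≡ b * X + suc (suc p) * d * Z
  collect = solve-∀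

-- The second inequality of part (b): D ≤ k·m·n^(k-2).  Apply power-increment with
-- b = n - m and d = n - (n - m), so that b + d = n and d ≤ m.
degree-bound-estimate : ∀ k n m → 2 ≤ k → degreeBound k n m ≤ k * m * n ^ (k ∸ 2)
degree-bound-estimate (suc zero) n m (s≤s ())
degree-bound-estimate (suc (suc p)) n m _ = m≤n+o⇒m∸n≤o (n ^ suc p) (b ^ suc p) (begin
    n ^ suc p
  ≡⟨ cong (_^ suc p) (sym b+d≡n) ⟩
    (b + d) ^ suc p
  ≤⟨ power-increment p b d ⟩
    b ^ suc p + suc p * d * (b + d) ^ p
  ≡⟨ cong (λ z → b ^ suc p + suc p * d * z ^ p) b+d≡n ⟩
    b ^ suc p + suc p * d * n ^ p
  ≤⟨ +-monoʳ-≤ (b ^ suc p) (*-monoˡ-≤ (n ^ p) (*-mono-≤ (n≤1+n (suc p)) d≤m)) ⟩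
    b ^ suc p + suc (suc p) * m * n ^ p
  ∎)
  where
  open ≤-Reasoning
  b d : ℕ
  b = n ∸ m
  d = n ∸ b
  b+d≡n : b + d ≡ n
  b+d≡n = m+[n∸m]≡n (m∸n≤m n m)
  d≤m : d ≤ m
  d≤m = m≤n+o⇒m∸n≤o n b (subst (n ≤_) (+-comm m b) (m≤n+m∸n n m))

∏ : ∀ k → (Fin k → ℕ) → ℕ
∏ zero g = 1
∏ (suc k) g = g zero * ∏ k (g ∘ suc)

∏-mono : ∀ k {f g : Fin k → ℕ} → (∀ j → f j ≤ g j) → ∏ k f ≤ ∏ k g
∏-mono zero f≤g = ≤-refl
∏-mono (suc k) f≤g = *-mono-≤ (f≤g zero) (∏-mono k (f≤g ∘ suc))

∏-cong : ∀ k {f g : Fin k → ℕ} → (∀ j → f j ≡ g j) → ∏ k f ≡ ∏ k g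
∏-cong zero f≡g = refl
∏-cong (suc k) f≡g = cong₂ _*_ (f≡g zero) (∏-cong k (f≡g ∘ suc))

∏-const : ∀ k a → ∏ k (λ _ → a) ≡ a ^ k
∏-const zero a = refl
∏-const (suc k) a = cong (a *_) (∏-const k a)

∏-punchIn : ∀ k (i : Fin (suc k)) (g : Fin (suc k) → ℕ) → ∏ (suc k) g ≡ g i * ∏ k (g ∘ punchIn i)
∏-punchIn k zero g = refl
∏-punchIn (suc k) (suc i) g = begin
    g zero * ∏ (suc k) (g ∘ suc)
  ≡⟨ cong (g zero *_) (∏-punchIn k i (g ∘ suc)) ⟩
    g zero * (g (suc i) * ∏ k (g ∘ suc ∘ punchIn i))
  ≡⟨ x∙yz≈y∙xz (g zero) (g (suc i)) _ ⟩
    g (suc i) * (g zero * ∏ k (g ∘ suc ∘ punchIn i))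
  ∎
  where open ≡-Reasoning

unique-⊆-length : {A : Set} {xs ys : List A} → Unique xs → xs ⊆ ys → length xs ≤ length ys
unique-⊆-length {xs = []} _ _ = z≤n
unique-⊆-length {xs = x ∷ xs} {ys} (x∉xs ∷ uxs) xxs⊆ys with ∈-∃++ (xxs⊆ys (here refl))
... | us , vs , refl = begin
    suc (length xs)
  ≤⟨ s≤s (unique-⊆-length uxs xs⊆us++vs) ⟩
    suc (length (us ++ vs))
  ≡⟨ cong suc (length-++ us) ⟩
    suc (length us + length vs)
  ≡⟨ sym (+-suc (length us) (length vs)) ⟩
    length us + length (x ∷ vs)
  ≡⟨ sym (length-++ us) ⟩
    length (us ++ x ∷ vs)
  ∎
  where
  open ≤-Reasoning
  -- removing the occurrence of x from ys keeps xs inside, as x ∉ xs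
  xs⊆us++vs : xs ⊆ us ++ vs
  xs⊆us++vs {z} z∈xs with ∈-++⁻ us (xxs⊆ys (there z∈xs))
  ... | inj₁ z∈us = ∈-++⁺ˡ z∈us
  ... | inj₂ (here refl) = ⊥-elim (All.lookup x∉xs z∈xs refl)
  ... | inj₂ (there z∈vs) = ∈-++⁺ʳ us z∈vs

disjoint-length : {A : Set} {xs ys zs : List A} → Unique xs → Unique ys → Disjoint xs ys →
  xs ⊆ zs → ys ⊆ zs → length xs + length ys ≤ length zs
disjoint-length {xs = xs} uxs uys disj xs⊆zs ys⊆zs =
  subst (_≤ _) (length-++ xs) (unique-⊆-length (Unique.++⁺ uxs uys disj) xs++ys⊆zs)
  where
  xs++ys⊆zs : xs ++ _ ⊆ _
  xs++ys⊆zs v∈ with ∈-++⁻ xs v∈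
  ... | inj₁ v∈xs = xs⊆zs v∈xs
  ... | inj₂ v∈ys = ys⊆zs v∈ys

module _ {n : ℕ} where
  open DecMembership (_≟ᶠ_ {n}) using (_∈?_; _∉?_)

  complement : List (Fin n) → List (Fin n)
  complement F = filter (_∉? F) (allFin n)

  ∈-complement⁻ : ∀ {F y} → y ∈ complement F → y ∉ F
  ∈-complement⁻ {F} y∈ = proj₂ (∈-filter⁻ (_∉? F) {xs = allFin n} y∈)

  complement-unique : ∀ F → Unique (complement F)
  complement-unique F = Unique.filter⁺ (_∉? F) (Unique.allFin⁺ n)

  -- Each vertex is in F or in its complement, so n ≤ |complement F| + |F|.
  complement-length : ∀ F → n ∸ length F ≤ length (complement F)
  complement-length F = m≤n+o⇒m∸n≤o n (length F) (begin
      n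
    ≡⟨ sym (length-tabulate (λ y → y)) ⟩
      length (allFin n)
    ≤⟨ unique-⊆-length (Unique.allFin⁺ n) covered ⟩
      length (complement F ++ F)
    ≡⟨ length-++ (complement F) ⟩
      length (complement F) + length F
    ≡⟨ +-comm (length (complement F)) (length F) ⟩
      length F + length (complement F)
    ∎)
    where
    open ≤-Reasoning
    covered : allFin n ⊆ complement F ++ F
    covered {y} _ with y ∈? F
    ... | yes y∈F = ∈-++⁺ʳ (complement F) y∈F
    ... | no y∉F = ∈-++⁺ˡ (∈-filter⁺ (_∉? F) (∈-allFin y) y∉F)

length-cartesianProductWith : {A B C : Set} (f : A → B → C) (xs : List A) (ys : List B) →
  length (cartesianProductWith f xs ys) ≡ length xs * length ys
length-cartesianProductWith f [] ys = refl
length-cartesianProductWith f (x ∷ xs) ys = begin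
    length (map (f x) ys ++ cartesianProductWith f xs ys)
  ≡⟨ length-++ (map (f x) ys) ⟩
    length (map (f x) ys) + length (cartesianProductWith f xs ys)
  ≡⟨ cong₂ _+_ (length-map (f x) ys) (length-cartesianProductWith f xs ys) ⟩
    length ys + length xs * length ys
  ∎
  where open ≡-Reasoning

box : {A : Set} (k : ℕ) → (Fin k → List A) → List (Vec A k)
box zero S = [ [] ]
box (suc k) S = cartesianProductWith _∷_ (S zero) (box k (S ∘ suc))

box-length : {A : Set} (k : ℕ) (S : Fin k → List A) → length (box k S) ≡ ∏ k (length ∘ S)
box-length zero S = refl
box-length (suc k) S =
  trans (length-cartesianProductWith _∷_ (S zero) (box k (S ∘ suc)))
        (cong (length (S zero) *_) (box-length k (S ∘ suc)))

∈-box⁺ : {A : Set} (k : ℕ) (S : Fin k → List A) {e : Vec A k} → (∀ j → lookup e j ∈ S j) → e ∈ box k S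
∈-box⁺ zero S {[]} _ = here refl
∈-box⁺ (suc k) S {y ∷ e} e∈S = ∈-cartesianProductWith⁺ _∷_ (e∈S zero) (∈-box⁺ k (S ∘ suc) (e∈S ∘ suc))

∈-box⁻ : {A : Set} (k : ℕ) (S : Fin k → List A) {e : Vec A k} → e ∈ box k S → ∀ j → lookup e j ∈ S j
∈-box⁻ (suc k) S {y ∷ e} e∈ j with ∈-cartesianProductWith⁻ _∷_ (S zero) (box k (S ∘ suc)) e∈
∈-box⁻ (suc k) S {y ∷ e} e∈ zero | _ , _ , y∈ , _ , refl = y∈
∈-box⁻ (suc k) S {y ∷ e} e∈ (suc j) | _ , _ , _ , e∈′ , refl = ∈-box⁻ k (S ∘ suc) e∈′ j

box-unique : {A : Set} (k : ℕ) (S : Fin k → List A) → (∀ j → Unique (S j)) → Unique (box k S)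
box-unique zero S _ = [] ∷ []
box-unique (suc k) S uS =
  Unique.cartesianProductWith⁺ _∷_ ∷-injective (uS zero) (box-unique k (S ∘ suc) (uS ∘ suc))

module _ {A : Set} {k : ℕ} where

  -- S with class i replaced by the single entry x: its box consists of the vectors
  -- through x in class i with the other entries drawn from S.
  pinned : Fin k → A → (Fin k → List A) → Fin k → List A
  pinned i x S j with j ≟ᶠ i
  ... | yes _ = [ x ]
  ... | no _ = S j

  pinned-at : ∀ i x S → pinned i x S i ≡ [ x ]
  pinned-at i x S with i ≟ᶠ i
  ... | yes _ = refl
  ... | no i≢i = ⊥-elim (i≢i refl)

  pinned-off : ∀ i x S {j} → j ≢ i → pinned i x S j ≡ S j
  pinned-off i x S {j} j≢i with j ≟ᶠ i
  ... | yes j≡i = ⊥-elim (j≢i j≡i)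
  ... | no _ = refl

  ∈-pinned⁺ : ∀ i x S j {y} → (j ≡ i → y ≡ x) → (j ≢ i → y ∈ S j) → y ∈ pinned i x S j
  ∈-pinned⁺ i x S j at off with j ≟ᶠ i
  ... | yes j≡i = here (at j≡i)
  ... | no j≢i = off j≢i

  ∈-pinned-at⁻ : ∀ i x S {y} → y ∈ pinned i x S i → y ≡ x
  ∈-pinned-at⁻ i x S y∈ with here y≡x ← subst (_ ∈_) (pinned-at i x S) y∈ = y≡x

  ∈-pinned-off⁻ : ∀ i x S {j y} → j ≢ i → y ∈ pinned i x S j → y ∈ S j
  ∈-pinned-off⁻ i x S j≢i = subst (_ ∈_) (pinned-off i x S j≢i)

  pinned-unique : ∀ i x S → (∀ j → j ≢ i → Unique (S j)) → ∀ j → Unique (pinned i x S j)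
  pinned-unique i x S uS j with j ≟ᶠ i
  ... | yes _ = [] ∷ []
  ... | no j≢i = uS j j≢i

pinned-box-length : {A : Set} (k : ℕ) (i : Fin (suc k)) (x : A) (S : Fin (suc k) → List A) →
  length (box (suc k) (pinned i x S)) ≡ ∏ k (length ∘ S ∘ punchIn i)
pinned-box-length k i x S = begin
    length (box (suc k) (pinned i x S))
  ≡⟨ box-length (suc k) (pinned i x S) ⟩
    ∏ (suc k) (length ∘ pinned i x S)
  ≡⟨ ∏-punchIn k i (length ∘ pinned i x S) ⟩
    length (pinned i x S i) * ∏ k (length ∘ pinned i x S ∘ punchIn i)
  ≡⟨ cong₂ (λ a b → length a * b) (pinned-at i x S) (∏-cong k off) ⟩
    1 * ∏ k (length ∘ S ∘ punchIn i)
  ≡⟨ *-identityˡ _ ⟩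
    ∏ k (length ∘ S ∘ punchIn i)
  ∎
  where
  open ≡-Reasoning
  off : ∀ j → length (pinned i x S (punchIn i j)) ≡ length (S (punchIn i j))
  off j = cong length (pinned-off i x S (punchInᵢ≢i i j))

avoiding-edge : ∀ {k n} (H : KGraph k n) (i : Fin k) (x : Fin n) (m : ℕ) (F : Fin k → List (Fin n)) →
  (∀ j → j ≢ i → length (F j) ≤ m) → ¬ deg H (i , x) ≤ degreeBound k n m →
  Σ (Edge k n) λ e → e ∈ edges H × lookup e i ≡ x × (∀ j → j ≢ i → lookup e j ∉ F j)
avoiding-edge {suc k} {n} H i x m F |F|≤m high = decide (any? (_∈ᵉ? avoiding) through)
  where
  open DecMembership (≡-dec {n = suc k} (_≟ᶠ_ {n})) using () renaming (_∈?_ to _∈ᵉ?_)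

  through : List (Edge (suc k) n)
  through = filter (λ e → lookup e i ≟ᶠ x) (edges H)

  anything allowed : Fin (suc k) → List (Fin n)
  anything _ = allFin n
  allowed j = complement (F j)

  all-through avoiding : List (Edge (suc k) n)
  all-through = box (suc k) (pinned i x anything)
  avoiding = box (suc k) (pinned i x allowed)

  avoiding-length : (n ∸ m) ^ k ≤ length avoiding
  avoiding-length = begin
      (n ∸ m) ^ k
    ≡⟨ sym (∏-const k (n ∸ m)) ⟩
      ∏ k (λ _ → n ∸ m)
    ≤⟨ ∏-mono k (λ j → ≤-trans (∸-monoʳ-≤ n (|F|≤m _ (punchInᵢ≢i i j))) (complement-length (F (punchIn i j)))) ⟩
      ∏ k (length ∘ complement ∘ F ∘ punchIn i)
    ≡⟨ sym (pinned-box-length k i x allowed) ⟩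
      length avoiding
    ∎
    where open ≤-Reasoning

  all-through-length : length all-through ≡ n ^ k
  all-through-length = begin
      length all-through
    ≡⟨ pinned-box-length k i x anything ⟩
      ∏ k (λ _ → length (allFin n))
    ≡⟨ cong (λ a → ∏ k (λ _ → a)) (length-tabulate (λ y → y)) ⟩
      ∏ k (λ _ → n)
    ≡⟨ ∏-const k n ⟩
      n ^ k
    ∎
    where open ≡-Reasoning

  through⊆all-through : through ⊆ all-through
  through⊆all-through e∈ = ∈-box⁺ (suc k) (pinned i x anything) λ j →
    ∈-pinned⁺ i x anything j (λ { refl → proj₂ (∈-filter⁻ _ {xs = edges H} e∈) }) (λ _ → ∈-allFin _)

  avoiding⊆all-through : avoiding ⊆ all-through
  avoiding⊆all-through e∈ = ∈-box⁺ (suc k) (pinned i x anything) λ j →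
    ∈-pinned⁺ i x anything j (λ { refl → ∈-pinned-at⁻ i x allowed (∈-box⁻ (suc k) (pinned i x allowed) e∈ i) }) (λ _ → ∈-allFin _)

  -- if no edge through (i , x) avoids F, the two lists are disjoint inside the box
  decide : Dec (Any (_∈ avoiding) through) →
    Σ (Edge (suc k) n) λ e → e ∈ edges H × lookup e i ≡ x × (∀ j → j ≢ i → lookup e j ∉ F j)
  decide (yes found) with e , e∈through , e∈avoiding ← find found =
    e , proj₁ (∈-filter⁻ _ {xs = edges H} e∈through) ,
    ∈-pinned-at⁻ i x allowed (∈-box⁻ (suc k) (pinned i x allowed) e∈avoiding i) ,
    λ j j≢i → ∈-complement⁻ (∈-pinned-off⁻ i x allowed j≢i (∈-box⁻ (suc k) (pinned i x allowed) e∈avoiding j))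
  decide (no none) = ⊥-elim (high (begin
      length through
    ≤⟨ m+n≤o⇒m≤o∸n (length through) counted ⟩
      length all-through ∸ length avoiding
    ≤⟨ ∸-mono (≤-reflexive all-through-length) avoiding-length ⟩
      n ^ k ∸ (n ∸ m) ^ k
    ∎))
    where
    open ≤-Reasoning
    counted : length through + length avoiding ≤ length all-through
    counted = disjoint-length
      (Unique.filter⁺ _ (distinct H))
      (box-unique (suc k) (pinned i x allowed) (pinned-unique i x allowed (λ j _ → complement-unique (F j))))
      (λ (e∈through , e∈avoiding) → none (Any.map (λ { refl → e∈avoiding }) e∈through))
      through⊆all-through avoiding⊆all-through

HighDegree : ∀ {k n} → KGraph k n → ℕ → Vertex k n → Set
HighDegree {k} {n} H m v = ¬ deg H v ≤ degreeBound k n m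

-- Forbidding in each class the vertices of M and of R
-- (at most m of them), avoiding-edge gives an edge e through (i , x) such that
-- e ∷ M is a matching avoiding R.
extend-matching : ∀ {k n} (H : KGraph k n) (m : ℕ) {i : Fin k} {x : Fin n} (R : List (Vertex k n))
  (M : List (Edge k n)) → (i , x) ∉ R → HighDegree H m (i , x) →
  IsMatchingAvoiding H ((i , x) ∷ R) M → length M + length R ≤ m →
  Σ (Edge k n) λ e → IsMatchingAvoiding H R (e ∷ M)
extend-matching {k} {n} H m {i} {x} R M x∉R high ((M⊆H , M-disjoint) , M-avoids) size =
  adjoin (avoiding-edge H i x m forbidden forbidden-length high)
  where
  forbidden : Fin k → List (Fin n)
  forbidden j = map (λ f → lookup f j) M ++ map proj₂ R

  forbidden-length : ∀ j → j ≢ i → length (forbidden j) ≤ m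
  forbidden-length j _ = subst (_≤ m)
    (sym (trans (length-++ (map (λ f → lookup f j) M)) (cong₂ _+_ (length-map _ M) (length-map proj₂ R))))
    size

  adjoin : (Σ (Edge k n) λ e → e ∈ edges H × lookup e i ≡ x × (∀ j → j ≢ i → lookup e j ∉ forbidden j)) →
    Σ (Edge k n) λ e → IsMatchingAvoiding H R (e ∷ M)
  adjoin (e , e∈H , e∋x , e-free) =
    e , ((e∈H ∷ M⊆H) , (e-disjoint ∷ M-disjoint)) , (e-avoids ∷ All.map All.tail M-avoids)
    where
    -- in class i the edges of M miss x, elsewhere e misses their vertices
    e-disjoint : All (DisjointEdges e) M
    e-disjoint = All.tabulate λ {f} f∈M j ej≡fj → separate f f∈M j ej≡fj (j ≟ᶠ i)
      where
      separate : ∀ f → f ∈ M → ∀ j → lookup e j ≡ lookup f j → Dec (j ≡ i) → ⊥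
      separate f f∈M j ej≡fj (yes refl) = All.head (All.lookup M-avoids f∈M) (trans (sym ej≡fj) e∋x)
      separate f f∈M j ej≡fj (no j≢i) =
        e-free j j≢i (∈-++⁺ˡ (subst (_∈ _) (sym ej≡fj) (∈-map⁺ (λ f → lookup f j) f∈M)))

    -- in class i the vertices of R differ from x, elsewhere e misses them
    e-avoids : All (λ u → ¬ (e ∋ᵉ u)) R
    e-avoids = All.tabulate λ {u} u∈R → miss (proj₁ u) (proj₂ u) u∈R (proj₁ u ≟ᶠ i)
      where
      miss : ∀ j y → (j , y) ∈ R → Dec (j ≡ i) → lookup e j ≢ y
      miss j y u∈R (yes refl) ej≡y = x∉R (subst (λ z → (i , z) ∈ R) (trans (sym ej≡y) e∋x) u∈R)
      miss j y u∈R (no j≢i) ej≡y =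
        e-free j j≢i (∈-++⁺ʳ (map (λ f → lookup f j) M) (subst (_∈ _) (sym ej≡y) (∈-map⁺ proj₂ u∈R)))

greedy-matching : ∀ {k n} (H : KGraph k n) (m : ℕ) (R : List (Vertex k n)) (M : List (Edge k n)) →
  Unique R → All (HighDegree H m) R → IsMatchingAvoiding H R M → length M + length R ≤ suc m →
  Σ (List (Edge k n)) λ N → IsMatching H N × length N ≡ length M + length R
greedy-matching H m [] M _ _ (M-matching , _) _ = M , M-matching , sym (+-identityʳ (length M))
greedy-matching H m (v ∷ R) M (v∉R ∷ R-unique) (high ∷ highs) avoids size
  with size′ ← subst (_≤ suc m) (+-suc (length M) (length R)) size
  with e , avoids′ ← extend-matching H m R M (All¬⇒¬Any v∉R) high avoids (≤-pred size′)
  with N , N-matching , |N| ← greedy-matching H m R (e ∷ M) R-unique highs avoids′ size′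
  = N , N-matching , trans |N| (sym (+-suc (length M) (length R)))

low-degree-vertex : ∀ {k n} (H : KGraph k n) (m : ℕ) → (∀ N → IsMatching H N → length N ≤ m) →
  (R : List (Vertex k n)) → Unique R → (M : List (Edge k n)) → IsMatchingAvoiding H R M →
  length M + length R ≡ suc m → Σ (Vertex k n) λ v → v ∈ R × deg H v ≤ degreeBound k n m
low-degree-vertex {k} {n} H m maximal R R-unique M avoids size
  with any? (λ v → deg H v ≤? degreeBound k n m) R
... | yes low = find low
... | no none
  with N , N-matching , |N| ← greedy-matching H m R M R-unique (¬Any⇒All¬ R none) avoids (≤-reflexive size)
  = ⊥-elim (1+n≰n (subst (_≤ m) (trans |N| size) (maximal N N-matching)))

proposition3p2 : (k n m : ℕ) → 2 ≤ k → (H : KGraph k n) → MaxMatchingSize H m →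
    ((v : Vertex k n) → Σ (List (Edge k n)) (λ M → IsMatchingAvoiding H [ v ] M × length M ≡ m) →
      deg H v ≤ n ^ (k ∸ 1) ∸ (n ∸ m) ^ (k ∸ 1))
    × ((T : List (Vertex k n)) → LegalKSet T →
      Σ (List (Edge k n)) (λ M → IsMatchingAvoiding H T M × length M + k ≡ m + 1) →
      Σ (Vertex k n) (λ v → v ∈ T × deg H v ≤ n ^ (k ∸ 1) ∸ (n ∸ m) ^ (k ∸ 1)
        × n ^ (k ∸ 1) ∸ (n ∸ m) ^ (k ∸ 1) ≤ k * m * n ^ (k ∸ 2)))
proposition3p2 k n m 2≤k H (_ , maximal) = part-a , part-b
  where
  part-a : ∀ v → Σ (List (Edge k n)) (λ M → IsMatchingAvoiding H [ v ] M × length M ≡ m) →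
    deg H v ≤ degreeBound k n m
  part-a v (M , avoids , |M|)
    with _ , here refl , low ← low-degree-vertex H m maximal [ v ] ([] ∷ []) M avoids
                                 (trans (+-comm (length M) 1) (cong suc |M|))
    = low
  part-b : ∀ T → LegalKSet T → Σ (List (Edge k n)) (λ M → IsMatchingAvoiding H T M × length M + k ≡ m + 1) →
    Σ (Vertex k n) (λ v → v ∈ T × deg H v ≤ degreeBound k n m × degreeBound k n m ≤ k * m * n ^ (k ∸ 2))
  part-b T (T-unique , |T| , _) (M , avoids , size)
    with v , v∈T , low ← low-degree-vertex H m maximal T T-unique M avoids
                           (trans (cong (length M +_) |T|) (trans size (+-comm m 1)))
    = v , v∈T , low , degree-bound-estimate k n m 2≤k
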